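{- Let $G$ be an Eulerian ribbon graph and $F$ a forest of $G$ (a ribbon subgraph whose underlying graph contains no cycle). If $G/E(F)$ is checkerboard colourable, then $G$ is checkerboard colourable.
   Context: A ribbon graph is a (possibly non-orientable) surface with boundary written as a union of vertex discs and edge discs meeting in disjoint line segments (common line segments), each lying on exactly one vertex and one edge, each edge containing exactly two. The two boundary arcs of an edge disc other than its common line segments are its edge line segments. The degree of a vertex is the number of common line segments on it; $G$ is Eulerian if every vertex has even degree (connectivity not required). $G$ is checkerboard colourable if its boundary components can be coloured with two colours so that the two edge line segments of each edge receive different colours. For $A\subseteq E(G)$, $G/A=G^{\delta(A)}-A$, where $G^{\delta(A)}$ is the partial dual (in the arrow presentation, for each $e\in A$ with arrows $e',e''$: draw segments directed from the head of $e'$ to the tail of $e''$ and from the head of $e''$ to the tail of $e'$, both labelled $e$, and delete the arcs carrying $e',e''$). -}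

module Defs where

-- Ribbon graphs are encoded combinatorially by their "flags" (graph-encoded
-- maps / gems).  A flag is an endpoint of a common line segment, i.e. a
-- corner point on the boundary of the surface where a vertex disc, an edge
-- disc and the boundary meet.  Every edge disc carries exactly 4 flags.
--   τ₀ x : the other end of the edge line segment starting at x
--          (runs along the side of the edge disc to its other common segment)
--   τ₁ x : the other end of the vertex boundary arc starting at x
--          (runs along the boundary of the vertex disc to the next common segment)
--   τ₂ x : the other endpoint of the common line segment containing x
-- Vertices  = orbits of ⟨τ₁,τ₂⟩,  edges = orbits of ⟨τ₀,τ₂⟩,
-- boundary components = orbits of ⟨τ₀,τ₁⟩ (alternating edge line segments
-- and vertex arcs).  Common line segments = ⟨τ₂⟩-orbits (pairs).

open import Data.Nat using (ℕ; suc; _*_)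
open import Data.Nat.Divisibility using (_∣_)
open import Data.Fin using (Fin; zero; suc; inject₁; fromℕ)
open import Data.Bool using (Bool; true; false; if_then_else_)
open import Data.Product using (Σ; _×_; _,_; proj₁)
open import Data.Sum using (_⊎_)
open import Data.List using (List; length)
open import Data.List.Membership.Propositional using (_∈_)
open import Data.List.Relation.Unary.Unique.Propositional using (Unique)
open import Relation.Binary.PropositionalEquality using (_≡_; _≢_)
open import Relation.Nullary using (¬_)
open import Relation.Binary.Core using (Rel)
open import Relation.Binary.Construct.Closure.Equivalence using (EqClosure)

record Premap : Set where
  field
    n  : ℕ
    τ₀ τ₁ τ₂ : Fin n → Fin n

data Gen {A : Set} (f g : A → A) : A → A → Set where
  by-f : ∀ x → Gen f g x (f x)
  by-g : ∀ x → Gen f g x (g x)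

Orbit : {A : Set} → (A → A) → (A → A) → Rel A _
Orbit f g = EqClosure (Gen f g)

-- Ribbon graphs (possibly non-orientable, possibly disconnected)

record RibbonGraph : Set where
  field
    premap : Premap
  open Premap premap public
  field
    τ₀-invol : ∀ x → τ₀ (τ₀ x) ≡ x
    τ₁-invol : ∀ x → τ₁ (τ₁ x) ≡ x
    τ₂-invol : ∀ x → τ₂ (τ₂ x) ≡ x
    τ₀-fpf   : ∀ x → τ₀ x ≢ x
    τ₁-fpf   : ∀ x → τ₁ x ≢ x
    τ₂-fpf   : ∀ x → τ₂ x ≢ x
    τ₀τ₂-comm : ∀ x → τ₀ (τ₂ x) ≡ τ₂ (τ₀ x)
    τ₀≢τ₂    : ∀ x → τ₀ x ≢ τ₂ x      -- every edge orbit has exactly 4 flags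

module _ (P : Premap) where
  open Premap P

  SameVertex : Rel (Fin n) _
  SameVertex = Orbit τ₁ τ₂

  SameEdge : Rel (Fin n) _
  SameEdge = Orbit τ₀ τ₂

  SameBoundaryComponent : Rel (Fin n) _
  SameBoundaryComponent = Orbit τ₀ τ₁

  -- The vertex containing flag x has degree d: its set of flags, listed
  -- without repetition, has 2d elements (each common line segment on the
  -- vertex contributes its two endpoints).
  HasDegree : Fin n → ℕ → Set
  HasDegree x d =
    Σ (List (Fin n)) λ L →
      Unique L
      × (∀ y → y ∈ L → SameVertex x y)
      × (∀ y → SameVertex x y → y ∈ L)
      × length L ≡ 2 * d

  Eulerian : Set
  Eulerian = ∀ x d → HasDegree x d → 2 ∣ d

  -- Checkerboard colourable: a 2-colouring of the boundary components (a
  -- colouring of flags constant on boundary components) such that the two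
  -- edge line segments of every edge, {x , τ₀ x} and {τ₂ x , τ₀ (τ₂ x)},
  -- get different colours.
  CheckerboardColourable : Set
  CheckerboardColourable =
    Σ (Fin n → Bool) λ c →
      (∀ x y → SameBoundaryComponent x y → c x ≡ c y)
      × (∀ x → c x ≢ c (τ₂ x))

record EdgeSet (G : RibbonGraph) : Set where
  open RibbonGraph G
  field
    mem : Fin n → Bool
    mem-τ₀ : ∀ x → mem (τ₀ x) ≡ mem x
    mem-τ₂ : ∀ x → mem (τ₂ x) ≡ mem x

-- Partial dual G^{δ(A)}: on the flags of edges in A, τ₀ and τ₂ are swapped
-- (the gem description of the arrow-presentation construction).

partialDual : (G : RibbonGraph) → EdgeSet G → Premap
partialDual G A = record
  { n  = n
  ; τ₀ = λ x → if mem x then τ₂ x else τ₀ x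
  ; τ₁ = τ₁
  ; τ₂ = λ x → if mem x then τ₀ x else τ₂ x
  }
  where open RibbonGraph G
        open EdgeSet A

-- Edge line segments and common
-- line segments of the remaining edges are unchanged.  The vertex boundary
-- arc of P - D starting at a flag x follows the vertex boundary of P,
-- passing across the common line segments of deleted edges:

module _ (P : Premap) (D : Fin (Premap.n P) → Bool) where
  open Premap P

  data VertexArcDel : Fin n → Fin n → Set where
    stop : ∀ x → D (τ₁ x) ≡ false → VertexArcDel x (τ₁ x)
    skip : ∀ x {y} → D (τ₁ x) ≡ true → VertexArcDel (τ₂ (τ₁ x)) y → VertexArcDel x y

  FlagDel : Set
  FlagDel = Σ (Fin n) λ x → D x ≡ false

  data BoundaryStepDel : FlagDel → FlagDel → Set where
    side : ∀ x y → proj₁ y ≡ τ₀ (proj₁ x) → BoundaryStepDel x y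
    arc  : ∀ x y → VertexArcDel (proj₁ x) (proj₁ y) → BoundaryStepDel x y

  SameBoundaryComponentDel : Rel FlagDel _
  SameBoundaryComponentDel = EqClosure BoundaryStepDel

  CheckerboardColourableDel : Set
  CheckerboardColourableDel =
    Σ (FlagDel → Bool) λ c →
      (∀ x y → SameBoundaryComponentDel x y → c x ≡ c y)
      × (∀ x y → proj₁ y ≡ τ₂ (proj₁ x) → c x ≢ c y)

-- G / A = G^{δ(A)} - A is checkerboard colourable
CheckerboardColourableContraction : (G : RibbonGraph) → EdgeSet G → Set
CheckerboardColourableContraction G A =
  CheckerboardColourableDel (partialDual G A) (EdgeSet.mem A)

-- A cycle of length m+1 is given by flags x₀,…,x_m of edges in A
-- (x_i an end of the edge e_i at vertex v_i; τ₀ x_i lies at the other end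
-- of e_i) such that the other end of e_i is at v_{i+1} (indices mod m+1),
-- the edges e_i are pairwise distinct and the vertices v_i pairwise distinct.
-- (m = 0 : a loop;  m = 1 : two parallel edges.)

module _ (G : RibbonGraph) (A : EdgeSet G) where
  open RibbonGraph G
  open EdgeSet A

  Cycle : Set
  Cycle =
    Σ ℕ λ m → Σ (Fin (suc m) → Fin n) λ x →
      (∀ i → mem (x i) ≡ true)
      × (∀ (i : Fin m) → SameVertex premap (τ₀ (x (inject₁ i))) (x (suc i)))
      × SameVertex premap (τ₀ (x (fromℕ m))) (x zero)
      × (∀ i j → i ≢ j → ¬ SameEdge premap (x i) (x j))
      × (∀ i j → i ≢ j → ¬ SameVertex premap (x i) (x j))

  IsForest : Set
  IsForest = ¬ Cycle

-- Colour each flag of G by the colour, in G/F, of the first flag outside F on its boundary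
-- walk in G. A vertex arc of G/F is exactly such a stretch of boundary of G through edges of F,
-- so this colouring is constant on boundary components of G and changes across every edge not
-- in F. Suppose it does not change across a common line segment of an edge of F. Going around
-- the vertex at the far end of that edge, the colour changes an even number of times and the
-- degree is even, so it fails to change across a second segment there, which again lies on an
-- edge of F. Repeating this gives an infinite walk in F that never turns back along an edge;
-- its first return to a vertex closes a cycle, contradicting that F is a forest.
module Submission where

open import Defs
open import Data.Nat using (ℕ; zero; suc; _+_; _*_; _<_; _≤_; s≤s; z<s)
open import Data.Nat.Divisibility using (_∣_; divides)
open import Data.Nat.Properties
open import Data.Nat.DivMod using (_%_; _/_; m≡m%n+[m/n]*n; m%n<n)
open import Data.Nat.Induction using (<-rec)
open import Data.Fin using (Fin; toℕ; inject₁; fromℕ)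
open import Data.Bool using (Bool; true; false; not)
import Data.Bool.Properties as Bool
open import Axiom.UniquenessOfIdentityProofs using (module Decidable⇒UIP)
import Data.Fin.Properties as Fin
open import Data.Product using (Σ; ∃; _×_; _,_; proj₁; proj₂; map₂)
open import Data.Sum using (_⊎_; inj₁; inj₂)
open import Data.Empty using (⊥-elim)
open import Data.List using (List; _++_; applyUpTo; length)
open import Data.List.Properties using (length-++; length-applyUpTo)
open import Data.List.Membership.Propositional using (_∈_)
open import Data.List.Relation.Unary.Unique.Propositional using (Unique)
open import Data.List.Membership.Propositional.Properties
  using (∈-++⁺ˡ; ∈-++⁺ʳ; ∈-++⁻; ∈-applyUpTo⁺; ∈-applyUpTo⁻)
import Data.List.Relation.Unary.Unique.Propositional.Properties as Unique
open import Function.Base using (_∘_)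
open import Function.Definitions using (Injective)
open import Relation.Binary.PropositionalEquality
open import Relation.Binary.Construct.Closure.ReflexiveTransitive using (ε; _◅_; _◅◅_)
open import Relation.Binary.Construct.Closure.Symmetric using (fwd; bwd)
open import Relation.Binary.Construct.Closure.Equivalence using (symmetric; gfold)
open import Relation.Binary.Definitions using (tri<; tri≈; tri>)
open import Relation.Nullary using (¬_; Dec; yes; no; contradiction)
import Relation.Nullary.Decidable as Dec
open import Relation.Nullary.Decidable using (_×-dec_)
open import Relation.Unary using (Pred; Decidable)
open import Level using (0ℓ)

module _ {P : Pred ℕ 0ℓ} (P? : Decidable P) where
  Least : Set
  Least = ∃ λ m → P m × (∀ {k} → k < m → ¬ P k)

  leastWitness : ∀ {b} → P b → Least
  leastWitness {b} = <-rec (λ b → P b → Least) search b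
    where
      search : ∀ b → (∀ {k} → k < b → P k → Least) → P b → Least
      search b smaller pb with anyUpTo? P? b
      ... | yes (k , k<b , pk) = smaller k<b pk
      ... | no none = b , pb , λ k<b pk → none (_ , k<b , pk)

involutive⇒injective : {A : Set} {f : A → A} → (∀ x → f (f x) ≡ x) → Injective _≡_ _≡_ f
involutive⇒injective {f = f} invol {x} {y} fx≡fy =
  trans (sym (invol x)) (trans (cong f fx≡fy) (invol y))

module Iteration {A : Set} where
  open import Function.Endo.Propositional A using (_^_; ^-homo) public

  module _ (f : A → A) where

    ^-pointwise-+ : ∀ m k x → (f ^ (m + k)) x ≡ (f ^ m) ((f ^ k) x)
    ^-pointwise-+ m k x = cong-app (^-homo f m k) x

    ^-sucʳ : ∀ k x → (f ^ suc k) x ≡ (f ^ k) (f x)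
    ^-sucʳ k x = trans (cong (λ j → (f ^ j) x) (+-comm 1 k)) (^-pointwise-+ k 1 x)

    ^-injective : Injective _≡_ _≡_ f → ∀ k → Injective _≡_ _≡_ (f ^ k)
    ^-injective inj zero    eq = eq
    ^-injective inj (suc k) eq = ^-injective inj k (inj eq)

    module _ {p x} (period : (f ^ suc p) x ≡ x) where
      ^-period-multiple : ∀ m → (f ^ (m * suc p)) x ≡ x
      ^-period-multiple zero    = refl
      ^-period-multiple (suc m) = begin
        (f ^ (suc p + m * suc p)) x     ≡⟨ ^-pointwise-+ (suc p) (m * suc p) x ⟩
        (f ^ suc p) ((f ^ (m * suc p)) x) ≡⟨ cong (f ^ suc p) (^-period-multiple m) ⟩
        (f ^ suc p) x                   ≡⟨ period ⟩
        x                               ∎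
        where open ≡-Reasoning

      ^-mod-period : ∀ j → (f ^ j) x ≡ (f ^ (j % suc p)) x
      ^-mod-period j = begin
        (f ^ j) x                                        ≡⟨ cong (λ i → (f ^ i) x) (m≡m%n+[m/n]*n j (suc p)) ⟩
        (f ^ (j % suc p + (j / suc p) * suc p)) x         ≡⟨ ^-pointwise-+ (j % suc p) _ x ⟩
        (f ^ (j % suc p)) ((f ^ ((j / suc p) * suc p)) x) ≡⟨ cong (f ^ (j % suc p)) (^-period-multiple (j / suc p)) ⟩
        (f ^ (j % suc p)) x                              ∎
        where open ≡-Reasoning

module _ {n} (f : Fin n → Fin n) (f-inj : Injective _≡_ _≡_ f) where
  open Iteration

  -- Opaque: only the existence of a period matters, and unfolding the pigeonhole search is expensive.
  opaque
    period : ∀ x → ∃ λ p → (f ^ suc p) x ≡ x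
    period x with Fin.pigeonhole (n<1+n n) (λ i → (f ^ toℕ i) x)
    ... | i , j , i<j , fⁱx≡fʲx with m≤n⇒∃[o]m+o≡n i<j
    ...   | p , 1+i+p≡j = p , sym (^-injective f f-inj (toℕ i) (begin
        (f ^ toℕ i) x                ≡⟨ fⁱx≡fʲx ⟩
        (f ^ toℕ j) x                ≡⟨ cong (λ k → (f ^ k) x) (trans (sym 1+i+p≡j) (sym (+-suc (toℕ i) p))) ⟩
        (f ^ (toℕ i + suc p)) x      ≡⟨ ^-pointwise-+ f (toℕ i) (suc p) x ⟩
        (f ^ toℕ i) ((f ^ suc p) x)  ∎))
      where open ≡-Reasoning

    minimalPeriod : ∀ x → ∃ λ p → (f ^ suc p) x ≡ x × (∀ {k} → k < p → (f ^ suc k) x ≢ x)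
    minimalPeriod x with p , fᵖx≡x ← period x =
      leastWitness {λ k → (f ^ suc k) x ≡ x} (λ k → (f ^ suc k) x Fin.≟ x) {p} fᵖx≡x

module _ {A : Set} {f g : A → A} (f-invol : ∀ x → f (f x) ≡ x) (g-invol : ∀ x → g (g x) ≡ x)
         (P : A → Set) (P-f : ∀ {x} → P x → P (f x)) (P-g : ∀ {x} → P x → P (g x)) where

  orbit-closed : ∀ {x y} → Orbit f g x y → P x → P y
  orbit-closed ε                   px = px
  orbit-closed (fwd (by-f x) ◅ xy) px = orbit-closed xy (P-f px)
  orbit-closed (fwd (by-g x) ◅ xy) px = orbit-closed xy (P-g px)
  orbit-closed (bwd (by-f x) ◅ xy) px = orbit-closed xy (subst P (f-invol x) (P-f px))
  orbit-closed (bwd (by-g x) ◅ xy) px = orbit-closed xy (subst P (g-invol x) (P-g px))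

pairwise-on-Fin : ∀ {m} (P : ℕ → ℕ → Set) → (∀ {a b} → P a b → P b a) →
                  (∀ {a b} → a < b → b ≤ m → P a b) →
                  ∀ (i j : Fin (suc m)) → i ≢ j → P (toℕ i) (toℕ j)
pairwise-on-Fin P P-sym P-< i j i≢j with <-cmp (toℕ i) (toℕ j)
... | tri< i<j _ _ = P-< i<j (≤-pred (Fin.toℕ<n j))
... | tri≈ _ i≡j _ = contradiction (Fin.toℕ-injective i≡j) i≢j
... | tri> _ _ j<i = P-sym (P-< j<i (≤-pred (Fin.toℕ<n i)))

module BoundaryWalk (G : RibbonGraph) (F : EdgeSet G) where
  open RibbonGraph G
  open EdgeSet F
  open Iteration {Fin n}

  G/F : Premap
  G/F = partialDual G F

  β : Fin n → Fin n
  β z = τ₀ (τ₁ z)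

  β-injective : Injective _≡_ _≡_ β
  β-injective = involutive⇒injective {f = τ₁} τ₁-invol ∘ involutive⇒injective {f = τ₀} τ₀-invol

  β-τ₀-β : ∀ z → β (τ₀ (β z)) ≡ τ₀ z
  β-τ₀-β z = begin
    τ₀ (τ₁ (τ₀ (τ₀ (τ₁ z)))) ≡⟨ cong (τ₀ ∘ τ₁) (τ₀-invol (τ₁ z)) ⟩
    τ₀ (τ₁ (τ₁ z))           ≡⟨ cong τ₀ (τ₁-invol z) ⟩
    τ₀ z                     ∎
    where open ≡-Reasoning

  β-reversed-by-τ₀ : ∀ i z → (β ^ i) (τ₀ ((β ^ i) z)) ≡ τ₀ z
  β-reversed-by-τ₀ zero    z = refl
  β-reversed-by-τ₀ (suc i) z = begin
    (β ^ suc i) (τ₀ (β ((β ^ i) z)))   ≡⟨ ^-sucʳ β i _ ⟩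
    (β ^ i) (β (τ₀ (β ((β ^ i) z))))   ≡⟨ cong (β ^ i) (β-τ₀-β _) ⟩
    (β ^ i) (τ₀ ((β ^ i) z))           ≡⟨ β-reversed-by-τ₀ i z ⟩
    τ₀ z                               ∎
    where open ≡-Reasoning

  mem-β : ∀ z → mem (β z) ≡ mem (τ₁ z)
  mem-β z = mem-τ₀ (τ₁ z)

  -- FirstExit z y: y is the first flag outside F on the boundary walk z, τ₁ z, β z, τ₁ (β z), … of G;
  -- these stretches of boundary are exactly the vertex arcs of G/F.
  data FirstExit : Fin n → Fin n → Set where
    exit : ∀ {z} → mem (τ₁ z) ≡ false → FirstExit z (τ₁ z)
    pass : ∀ {z y} → mem (τ₁ z) ≡ true → FirstExit (β z) y → FirstExit z y

  firstExit-∉ : ∀ {z y} → FirstExit z y → mem y ≡ false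
  firstExit-∉ (exit y∉F) = y∉F
  firstExit-∉ (pass _ r) = firstExit-∉ r

  firstExit-unique : ∀ {z y y′} → FirstExit z y → FirstExit z y′ → y ≡ y′
  firstExit-unique (exit _)   (exit _)    = refl
  firstExit-unique (exit ∉F)  (pass ∈F _) = contradiction (trans (sym ∈F) ∉F) λ ()
  firstExit-unique (pass ∈F _) (exit ∉F)  = contradiction (trans (sym ∈F) ∉F) λ ()
  firstExit-unique (pass _ r) (pass _ r′) = firstExit-unique r r′

  firstExit⇒vertexArc : ∀ {z y} → FirstExit z y → VertexArcDel G/F mem z y
  firstExit⇒vertexArc (exit y∉F) = stop _ y∉F
  firstExit⇒vertexArc {z} {y} (pass τ₁z∈F r) =
    skip z τ₁z∈F (subst (λ w → VertexArcDel G/F mem w y) dual-τ₂ (firstExit⇒vertexArc r))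
    where
      dual-τ₂ : β z ≡ Premap.τ₂ G/F (τ₁ z)
      dual-τ₂ rewrite τ₁z∈F = refl

  β-undoes-τ₁-τ₀ : ∀ w → β (τ₁ (τ₀ w)) ≡ w
  β-undoes-τ₁-τ₀ w = trans (cong τ₀ (τ₁-invol (τ₀ w))) (τ₀-invol w)

  firstExit-reenter : ∀ {w y} → mem w ≡ true → FirstExit w y → FirstExit (τ₁ (τ₀ w)) y
  firstExit-reenter {w} {y} w∈F r =
    pass (trans (cong mem (τ₁-invol (τ₀ w))) (trans (mem-τ₀ w) w∈F))
         (subst (λ v → FirstExit v y) (sym (β-undoes-τ₁-τ₀ w)) r)

  firstExit-through : ∀ {w a y} → mem w ≡ true → FirstExit (τ₀ w) a → FirstExit w y → FirstExit a y
  firstExit-through w∈F (exit _)         r = firstExit-reenter w∈F r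
  firstExit-through w∈F (pass τ₁τ₀w∈F ra) r = firstExit-through τ₁τ₀w∈F ra (firstExit-reenter w∈F r)

  LeavesF : Fin n → Set
  LeavesF z = ∃ λ j → mem ((β ^ j) z) ≡ false

  firstExit⇒leavesF : ∀ {z y} → FirstExit z y → LeavesF z
  firstExit⇒leavesF (exit τ₁z∉F) = 1 , trans (mem-β _) τ₁z∉F
  firstExit⇒leavesF {z} (pass _ r) with j , βʲβz∉F ← firstExit⇒leavesF r =
    suc j , trans (cong mem (^-sucʳ β j z)) βʲβz∉F

  firstExit-from : ∀ k z → mem ((β ^ suc k) z) ≡ false → ∃ (FirstExit z)
  firstExit-from k z _ with mem (τ₁ z) in τ₁z∈?F
  ... | false = τ₁ z , exit τ₁z∈?F
  firstExit-from zero z βz∉F | true =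
    contradiction (trans (sym τ₁z∈?F) (trans (sym (mem-β z)) βz∉F)) λ ()
  firstExit-from (suc k) z βᵏ⁺²z∉F | true =
    map₂ (pass τ₁z∈?F) (firstExit-from k (β z) (trans (cong mem (sym (^-sucʳ β (suc k) z))) βᵏ⁺²z∉F))

  leavesF⇒firstExit : ∀ {z} → LeavesF z → ∃ (FirstExit z)
  leavesF⇒firstExit {z} (j , βʲz∉F) with p , βᵖ⁺¹z≡z ← period β β-injective z =
    firstExit-from (j + p) z (begin
      mem ((β ^ suc (j + p)) z)         ≡⟨ cong (λ k → mem ((β ^ k) z)) (sym (+-suc j p)) ⟩
      mem ((β ^ (j + suc p)) z)         ≡⟨ cong mem (^-pointwise-+ β j (suc p) z) ⟩
      mem ((β ^ j) ((β ^ suc p) z))     ≡⟨ cong (mem ∘ (β ^ j)) βᵖ⁺¹z≡z ⟩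
      mem ((β ^ j) z)                   ≡⟨ βʲz∉F ⟩
      false                             ∎)
    where open ≡-Reasoning

  opaque
    leavesF? : ∀ z → Dec (LeavesF z)
    leavesF? z with p , βᵖ⁺¹z≡z ← period β β-injective z
               with anyUpTo? (λ j → mem ((β ^ j) z) Bool.≟ false) (suc p)
    ... | yes (j , _ , βʲz∉F) = yes (j , βʲz∉F)
    ... | no none = no λ (j , βʲz∉F) →
          none (j % suc p , m%n<n j (suc p) , trans (cong mem (sym (^-mod-period β βᵖ⁺¹z≡z j))) βʲz∉F)

  leavesF-τ₀ : ∀ {z} → LeavesF z → LeavesF (τ₀ z)
  leavesF-τ₀ {z} (j , βʲz∉F) with p , βᵖ⁺¹z≡z ← period β β-injective z =
    j * p , (begin
      mem ((β ^ (j * p)) (τ₀ z))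
        ≡⟨ cong (mem ∘ (β ^ (j * p)) ∘ τ₀) (sym z≡βⁱ⁺ʲz) ⟩
      mem ((β ^ (j * p)) (τ₀ ((β ^ (j * p)) ((β ^ j) z))))
        ≡⟨ cong mem (β-reversed-by-τ₀ (j * p) _) ⟩
      mem (τ₀ ((β ^ j) z))
        ≡⟨ mem-τ₀ _ ⟩
      mem ((β ^ j) z)
        ≡⟨ βʲz∉F ⟩
      false
        ∎)
    where
      open ≡-Reasoning
      z≡βⁱ⁺ʲz : (β ^ (j * p)) ((β ^ j) z) ≡ z
      z≡βⁱ⁺ʲz = begin
        (β ^ (j * p)) ((β ^ j) z) ≡⟨ ^-pointwise-+ β (j * p) j z ⟨
        (β ^ (j * p + j)) z      ≡⟨ cong (λ k → (β ^ k) z) (trans (+-comm (j * p) j) (sym (*-suc j p))) ⟩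
        (β ^ (j * suc p)) z      ≡⟨ ^-period-multiple β βᵖ⁺¹z≡z j ⟩
        z                        ∎

  module LiftedColouring (c′ : FlagDel G/F mem → Bool)
                         (c′-boundary : ∀ x y → SameBoundaryComponentDel G/F mem x y → c′ x ≡ c′ y)
                         (c′-flip : ∀ x y → proj₁ y ≡ Premap.τ₂ G/F (proj₁ x) → c′ x ≢ c′ y) where

    c′-irrelevant : ∀ {y} (p q : mem y ≡ false) → c′ (y , p) ≡ c′ (y , q)
    c′-irrelevant p q = cong (λ r → c′ (_ , r)) (Decidable⇒UIP.≡-irrelevant Bool._≟_ p q)

    c′-firstExit : ∀ {z y} (z∉F : mem z ≡ false) (y∉F : mem y ≡ false) →
                   FirstExit z y → c′ (z , z∉F) ≡ c′ (y , y∉F)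
    c′-firstExit _ _ r = c′-boundary _ _ (fwd (arc _ _ (firstExit⇒vertexArc r)) ◅ ε)

    -- Boundary components of G lying entirely in F get an arbitrary colour.
    colour : Fin n → Bool
    colour z with leavesF? z
    ... | yes l = let y , r = leavesF⇒firstExit l in c′ (y , firstExit-∉ r)
    ... | no _  = false

    colour-firstExit : ∀ {z y} (y∉F : mem y ≡ false) → FirstExit z y → colour z ≡ c′ (y , y∉F)
    colour-firstExit {z} y∉F r with leavesF? z
    ... | no ¬l = contradiction (firstExit⇒leavesF r) ¬l
    ... | yes l with firstExit-unique (proj₂ (leavesF⇒firstExit l)) r
    ...   | refl = c′-irrelevant _ _

    colour-¬leavesF : ∀ {z} → ¬ LeavesF z → colour z ≡ false
    colour-¬leavesF {z} ¬l with leavesF? z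
    ... | yes l = contradiction l ¬l
    ... | no _  = refl

    colour-∉F : ∀ {z} (z∉F : mem z ≡ false) → colour z ≡ c′ (z , z∉F)
    colour-∉F {z} z∉F with y , r ← leavesF⇒firstExit (0 , z∉F) =
      trans (colour-firstExit (firstExit-∉ r) r) (sym (c′-firstExit z∉F _ r))

    colour-τ₀ : ∀ z → colour (τ₀ z) ≡ colour z
    colour-τ₀ z with mem z in z∈?F
    ... | false = begin
      colour (τ₀ z)        ≡⟨ colour-∉F τ₀z∉F ⟩
      c′ (τ₀ z , τ₀z∉F)    ≡⟨ c′-boundary _ _ (bwd (side _ _ dual-τ₀) ◅ ε) ⟩
      c′ (z , z∈?F)        ≡⟨ colour-∉F z∈?F ⟨
      colour z             ∎
      where
        open ≡-Reasoning
        τ₀z∉F : mem (τ₀ z) ≡ false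
        τ₀z∉F = trans (mem-τ₀ z) z∈?F
        dual-τ₀ : τ₀ z ≡ Premap.τ₀ G/F z
        dual-τ₀ rewrite z∈?F = refl
    ... | true = colour-τ₀-∈F z∈?F (leavesF? z)
      where
        colour-τ₀-∈F : mem z ≡ true → Dec (LeavesF z) → colour (τ₀ z) ≡ colour z
        colour-τ₀-∈F z∈F (yes l)
          with y , r ← leavesF⇒firstExit l | a , rₐ ← leavesF⇒firstExit (leavesF-τ₀ l) = begin
            colour (τ₀ z)               ≡⟨ colour-firstExit (firstExit-∉ rₐ) rₐ ⟩
            c′ (a , firstExit-∉ rₐ)     ≡⟨ c′-firstExit _ _ (firstExit-through z∈F rₐ r) ⟩
            c′ (y , firstExit-∉ r)      ≡⟨ colour-firstExit (firstExit-∉ r) r ⟨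
            colour z                    ∎
          where open ≡-Reasoning
        colour-τ₀-∈F z∈F (no ¬l) =
          trans (colour-¬leavesF (¬l ∘ subst LeavesF (τ₀-invol z) ∘ leavesF-τ₀)) (sym (colour-¬leavesF ¬l))

    colour-cong : ∀ {z w} → (∀ {y} → FirstExit z y → FirstExit w y) →
                  (∀ {y} → FirstExit w y → FirstExit z y) → colour z ≡ colour w
    colour-cong {z} {w} to from = by-cases (leavesF? z)
      where
        by-cases : Dec (LeavesF z) → colour z ≡ colour w
        by-cases (yes l) with y , r ← leavesF⇒firstExit l =
          trans (colour-firstExit (firstExit-∉ r) r) (sym (colour-firstExit (firstExit-∉ r) (to r)))
        by-cases (no ¬l) =
          trans (colour-¬leavesF ¬l)
                (sym (colour-¬leavesF λ lw → ¬l (firstExit⇒leavesF (from (proj₂ (leavesF⇒firstExit lw))))))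

    colour-τ₁ : ∀ z → colour (τ₁ z) ≡ colour z
    colour-τ₁ z with mem z in z∈?F
    ... | false = trans (colour-firstExit z∈?F τ₁z-exits-at-z) (sym (colour-∉F z∈?F))
      where
        τ₁z-exits-at-z : FirstExit (τ₁ z) z
        τ₁z-exits-at-z = subst (FirstExit (τ₁ z)) (τ₁-invol z) (exit (trans (cong mem (τ₁-invol z)) z∈?F))
    ... | true = trans (colour-cong to from) (colour-τ₀ z)
      where
        τ₁τ₁z∈F : mem (τ₁ (τ₁ z)) ≡ true
        τ₁τ₁z∈F = trans (cong mem (τ₁-invol z)) z∈?F
        βτ₁z≡τ₀z : β (τ₁ z) ≡ τ₀ z
        βτ₁z≡τ₀z = cong τ₀ (τ₁-invol z)
        to : ∀ {y} → FirstExit (τ₁ z) y → FirstExit (τ₀ z) y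
        to (exit τ₁τ₁z∉F) = contradiction (trans (sym τ₁τ₁z∈F) τ₁τ₁z∉F) λ ()
        to {y} (pass _ r) = subst (λ v → FirstExit v y) βτ₁z≡τ₀z r
        from : ∀ {y} → FirstExit (τ₀ z) y → FirstExit (τ₁ z) y
        from {y} r = pass τ₁τ₁z∈F (subst (λ v → FirstExit v y) (sym βτ₁z≡τ₀z) r)

    colour-flips-∉F : ∀ z → mem z ≡ false → colour z ≢ colour (τ₂ z)
    colour-flips-∉F z z∉F colour-equal =
      c′-flip (z , z∉F) (τ₂ z , τ₂z∉F) dual-τ₂
        (trans (sym (colour-∉F z∉F)) (trans colour-equal (colour-∉F τ₂z∉F)))
      where
        τ₂z∉F : mem (τ₂ z) ≡ false
        τ₂z∉F = trans (mem-τ₂ z) z∉F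
        dual-τ₂ : τ₂ z ≡ Premap.τ₂ G/F z
        dual-τ₂ rewrite z∉F = refl

module Rotation (G : RibbonGraph) where
  open RibbonGraph G
  open Iteration {Fin n}

  ρ : Fin n → Fin n
  ρ z = τ₁ (τ₂ z)

  ρ-injective : Injective _≡_ _≡_ ρ
  ρ-injective = involutive⇒injective {f = τ₂} τ₂-invol ∘ involutive⇒injective {f = τ₁} τ₁-invol

  ρ-sameVertex : ∀ k z → SameVertex premap z ((ρ ^ k) z)
  ρ-sameVertex zero    z = ε
  ρ-sameVertex (suc k) z = ρ-sameVertex k z ◅◅ (fwd (by-g _) ◅ fwd (by-f _) ◅ ε)

  ρ-avoids-τ₂ : ∀ k u → (ρ ^ k) u ≢ τ₂ u
  ρ-avoids-τ₂ zero          u ρ⁰u≡τ₂u = τ₂-fpf u (sym ρ⁰u≡τ₂u)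
  ρ-avoids-τ₂ (suc zero)    u ρu≡τ₂u  = τ₁-fpf (τ₂ u) ρu≡τ₂u
  ρ-avoids-τ₂ (suc (suc k)) u ρᵏ⁺²u≡τ₂u = ρ-avoids-τ₂ k (ρ u) (begin
    (ρ ^ k) (ρ u)              ≡⟨ ^-sucʳ ρ k u ⟨
    (ρ ^ suc k) u              ≡⟨ sym (trans (cong τ₂ (τ₁-invol _)) (τ₂-invol _)) ⟩
    τ₂ (τ₁ ((ρ ^ suc (suc k)) u)) ≡⟨ cong (τ₂ ∘ τ₁) ρᵏ⁺²u≡τ₂u ⟩
    τ₂ (ρ u)                   ∎)
    where open ≡-Reasoning

  ρ-later-avoids-τ₂ : ∀ {s t} u → t ≤ s → (ρ ^ s) u ≢ τ₂ ((ρ ^ t) u)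
  ρ-later-avoids-τ₂ {s} {t} u t≤s eq with o , t+o≡s ← m≤n⇒∃[o]m+o≡n t≤s =
    ρ-avoids-τ₂ o ((ρ ^ t) u) (begin
      (ρ ^ o) ((ρ ^ t) u)  ≡⟨ ^-pointwise-+ ρ o t u ⟨
      (ρ ^ (o + t)) u      ≡⟨ cong (λ k → (ρ ^ k) u) (trans (+-comm o t) t+o≡s) ⟩
      (ρ ^ s) u            ≡⟨ eq ⟩
      τ₂ ((ρ ^ t) u)       ∎)
    where open ≡-Reasoning

  ρ-avoids-τ₂-orbit : ∀ s t u → (ρ ^ s) u ≢ τ₂ ((ρ ^ t) u)
  ρ-avoids-τ₂-orbit s t u eq with ≤-total t s
  ... | inj₁ t≤s = ρ-later-avoids-τ₂ u t≤s eq
  ... | inj₂ s≤t = ρ-later-avoids-τ₂ u s≤t (trans (sym (τ₂-invol _)) (cong τ₂ (sym eq)))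

  module Vertex (w : Fin n) where
    private
      minimal = minimalPeriod ρ ρ-injective w

    degree : ℕ
    degree = suc (proj₁ minimal)

    ρ-period : (ρ ^ degree) w ≡ w
    ρ-period = proj₁ (proj₂ minimal)

    ρ-returns-late : ∀ {s t} → s < t → t < degree → (ρ ^ t) w ≢ (ρ ^ s) w
    ρ-returns-late {s} {t} s<t t<d ρᵗw≡ρˢw with k , 1+s+k≡t ← m≤n⇒∃[o]m+o≡n s<t =
      proj₂ (proj₂ minimal) k<q (^-injective ρ ρ-injective s (begin
        (ρ ^ s) ((ρ ^ suc k) w)  ≡⟨ ^-pointwise-+ ρ s (suc k) w ⟨
        (ρ ^ (s + suc k)) w      ≡⟨ cong (λ j → (ρ ^ j) w) s+1+k≡t ⟩
        (ρ ^ t) w                ≡⟨ ρᵗw≡ρˢw ⟩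
        (ρ ^ s) w                ∎))
      where
        open ≡-Reasoning
        s+1+k≡t : s + suc k ≡ t
        s+1+k≡t = trans (+-suc s k) 1+s+k≡t
        k<q : k < proj₁ minimal
        k<q = ≤-trans (m≤n+m (suc k) s) (≤-pred (subst (_< degree) (sym s+1+k≡t) t<d))

    ρ-orbit-injective : ∀ {s t} → s < degree → t < degree → (ρ ^ s) w ≡ (ρ ^ t) w → s ≡ t
    ρ-orbit-injective {s} {t} s<d t<d eq with <-cmp s t
    ... | tri< s<t _ _ = contradiction (sym eq) (ρ-returns-late s<t t<d)
    ... | tri≈ _ s≡t _ = s≡t
    ... | tri> _ _ t<s = contradiction eq (ρ-returns-late t<s s<d)

    ρ-orbit : ℕ → Fin n
    ρ-orbit t = (ρ ^ t) w

    orbit τ₂-orbit flags : List (Fin n)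
    orbit = applyUpTo ρ-orbit degree
    τ₂-orbit = applyUpTo (τ₂ ∘ ρ-orbit) degree
    flags = orbit ++ τ₂-orbit

    ρ-orbit∈flags : ∀ {t} → t < degree → (ρ ^ t) w ∈ flags
    ρ-orbit∈flags t<d = ∈-++⁺ˡ (∈-applyUpTo⁺ ρ-orbit t<d)

    τ₂-orbit∈flags : ∀ {t} → t < degree → τ₂ ((ρ ^ t) w) ∈ flags
    τ₂-orbit∈flags t<d = ∈-++⁺ʳ orbit (∈-applyUpTo⁺ (τ₂ ∘ ρ-orbit) t<d)

    ∈flags⁻ : ∀ {y} → y ∈ flags → ∃ λ t → t < degree × (y ≡ (ρ ^ t) w ⊎ y ≡ τ₂ ((ρ ^ t) w))
    ∈flags⁻ y∈flags with ∈-++⁻ orbit y∈flags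
    ... | inj₁ y∈orbit   = map₂ (map₂ inj₁) (∈-applyUpTo⁻ ρ-orbit y∈orbit)
    ... | inj₂ y∈τ₂orbit = map₂ (map₂ inj₂) (∈-applyUpTo⁻ (τ₂ ∘ ρ-orbit) y∈τ₂orbit)

    flags-unique : Unique flags
    flags-unique = Unique.++⁺
      (Unique.applyUpTo⁺₁ ρ-orbit degree λ i<j j<d eq → <⇒≢ i<j (ρ-orbit-injective (<-trans i<j j<d) j<d eq))
      (Unique.applyUpTo⁺₁ (τ₂ ∘ ρ-orbit) degree λ i<j j<d eq →
        <⇒≢ i<j (ρ-orbit-injective (<-trans i<j j<d) j<d (involutive⇒injective {f = τ₂} τ₂-invol eq)))
      λ (v∈orbit , v∈τ₂orbit) → let s , _ , v≡ρˢw = ∈-applyUpTo⁻ ρ-orbit v∈orbit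
                                    t , _ , v≡τ₂ρᵗw = ∈-applyUpTo⁻ (τ₂ ∘ ρ-orbit) v∈τ₂orbit
                                in ρ-avoids-τ₂-orbit s t w (trans (sym v≡ρˢw) v≡τ₂ρᵗw)

    flags-length : length flags ≡ 2 * degree
    flags-length = begin
      length flags                    ≡⟨ length-++ orbit ⟩
      length orbit + length τ₂-orbit  ≡⟨ cong₂ _+_ (length-applyUpTo ρ-orbit degree)
                                                    (length-applyUpTo (τ₂ ∘ ρ-orbit) degree) ⟩
      degree + degree                 ≡⟨ cong (degree +_) (+-identityʳ degree) ⟨
      2 * degree                      ∎
      where open ≡-Reasoning

    flags-τ₂ : ∀ {y} → y ∈ flags → τ₂ y ∈ flags
    flags-τ₂ y∈flags with ∈flags⁻ y∈flags
    ... | t , t<d , inj₁ refl = τ₂-orbit∈flags t<d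
    ... | t , t<d , inj₂ refl = subst (_∈ flags) (sym (τ₂-invol _)) (ρ-orbit∈flags t<d)

    flags-τ₁ : ∀ {y} → y ∈ flags → τ₁ y ∈ flags
    flags-τ₁ y∈flags with ∈flags⁻ y∈flags
    ... | zero , _ , inj₁ refl =
      subst (_∈ flags) (trans (sym (τ₁-invol _)) (cong τ₁ ρ-period)) (τ₂-orbit∈flags ≤-refl)
    ... | suc t , t<d , inj₁ refl = subst (_∈ flags) (sym (τ₁-invol _)) (τ₂-orbit∈flags (<-trans (n<1+n t) t<d))
    ... | t , t<d , inj₂ refl with m≤n⇒m<n∨m≡n t<d
    ...   | inj₁ 1+t<d = ρ-orbit∈flags 1+t<d
    ...   | inj₂ 1+t≡d =
      subst (_∈ flags) (trans (sym ρ-period) (cong (λ k → (ρ ^ k) w) (sym 1+t≡d))) (ρ-orbit∈flags z<s)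

    flags-sameVertex : ∀ {y} → y ∈ flags → SameVertex premap w y
    flags-sameVertex y∈flags with ∈flags⁻ y∈flags
    ... | t , _ , inj₁ refl = ρ-sameVertex t w
    ... | t , _ , inj₂ refl = ρ-sameVertex t w ◅◅ (fwd (by-g _) ◅ ε)

    sameVertex-flags : ∀ {y} → SameVertex premap w y → y ∈ flags
    sameVertex-flags w~y = orbit-closed τ₁-invol τ₂-invol (_∈ flags) flags-τ₁ flags-τ₂ w~y (ρ-orbit∈flags z<s)

    hasDegree : HasDegree premap w degree
    hasDegree = flags , flags-unique , (λ _ → flags-sameVertex) , (λ _ → sameVertex-flags) , flags-length

    sameVertex? : ∀ y → Dec (SameVertex premap w y)
    sameVertex? y = Dec.map′ flags-sameVertex sameVertex-flags (y ∈? flags)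
      where open import Data.List.Membership.DecPropositional (Fin._≟_ {n}) using (_∈?_)

module _ (a : ℕ → Bool) where

  alternation-returns : ∀ s → (∀ {t} → 0 < t → t < suc (s + s) → a (suc t) ≢ a t) → a (suc (s + s)) ≡ a 1
  alternation-returns zero    _   = refl
  alternation-returns (suc s) alt = begin
    a (suc (suc s + suc s))     ≡⟨ cong (a ∘ suc) 2+2s ⟩
    a (3 + (s + s))             ≡⟨ Bool.¬-not (alt′ z<s (n<1+n _)) ⟩
    not (a (2 + (s + s)))       ≡⟨ cong not (Bool.¬-not (alt′ z<s (<-trans (n<1+n _) (n<1+n _)))) ⟩
    not (not (a (1 + (s + s)))) ≡⟨ Bool.not-involutive _ ⟩
    a (1 + (s + s))             ≡⟨ alternation-returns s (λ 0<t → alt′ 0<t ∘ m<n⇒m<1+n ∘ m<n⇒m<1+n) ⟩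
    a 1                         ∎
    where
      open ≡-Reasoning
      2+2s : suc s + suc s ≡ 2 + (s + s)
      2+2s = cong suc (+-suc s s)
      alt′ : ∀ {t} → 0 < t → t < 3 + (s + s) → a (suc t) ≢ a t
      alt′ {t} 0<t t<3+2s = alt 0<t (subst (t <_) (cong suc (sym 2+2s)) t<3+2s)

  repeat-elsewhere : ∀ q → 2 ∣ suc q → a (suc q) ≡ a 0 → a 1 ≡ a 0 →
                     ∃ λ t → 0 < t × t < suc q × a (suc t) ≡ a t
  repeat-elsewhere q 2∣1+q closed repeats₀
    with anyUpTo? (λ t → (0 <? t) ×-dec (a (suc t) Bool.≟ a t)) (suc q)
  ... | yes (t , t<1+q , 0<t , repeatsₜ) = t , 0<t , t<1+q , repeatsₜ
  ... | no none with divides (suc s) 1+q≡[1+s]*2 ← 2∣1+q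
                with refl ← trans 1+q≡[1+s]*2 (cong (2 +_) (trans (*-comm s 2) (cong (s +_) (+-identityʳ s)))) =
    ⊥-elim (Bool.not-¬ refl (begin
      a 0                   ≡⟨ closed ⟨
      a (2 + (s + s))       ≡⟨ Bool.¬-not (alternates z<s ≤-refl) ⟩
      not (a (1 + (s + s))) ≡⟨ cong not (alternation-returns s λ 0<t t<1+2s → alternates 0<t (m<n⇒m<1+n t<1+2s)) ⟩
      not (a 1)             ≡⟨ cong not repeats₀ ⟩
      not (a 0)             ∎))
    where
      open ≡-Reasoning
      alternates : ∀ {t} → 0 < t → t < 2 + (s + s) → a (suc t) ≢ a t
      alternates 0<t t<d repeatsₜ = none (_ , t<d , 0<t , repeatsₜ)

module Walks (G : RibbonGraph) (F : EdgeSet G) where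
  open RibbonGraph G
  open EdgeSet F

  -- v leaves the vertex at the far end of u's edge through a different common line segment.
  record NonBacktrackingStep (u v : Fin n) : Set where
    field
      ∈F     : mem u ≡ true
      arrive : SameVertex premap (τ₀ u) v
      ≢τ₀    : v ≢ τ₀ u
      ≢τ₂τ₀  : v ≢ τ₂ (τ₀ u)
  open NonBacktrackingStep

  EdgeFlag : Fin n → Fin n → Set
  EdgeFlag x y = y ≡ x ⊎ y ≡ τ₀ x ⊎ y ≡ τ₂ x ⊎ y ≡ τ₂ (τ₀ x)

  sameEdge⇒edgeFlag : ∀ {x y} → SameEdge premap x y → EdgeFlag x y
  sameEdge⇒edgeFlag {x} x~y =
    orbit-closed τ₀-invol τ₂-invol (EdgeFlag x) edgeFlag-τ₀ edgeFlag-τ₂ x~y (inj₁ refl)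
    where
      edgeFlag-τ₀ : ∀ {y} → EdgeFlag x y → EdgeFlag x (τ₀ y)
      edgeFlag-τ₀ (inj₁ refl)                = inj₂ (inj₁ refl)
      edgeFlag-τ₀ (inj₂ (inj₁ refl))         = inj₁ (τ₀-invol x)
      edgeFlag-τ₀ (inj₂ (inj₂ (inj₁ refl)))  = inj₂ (inj₂ (inj₂ (τ₀τ₂-comm x)))
      edgeFlag-τ₀ (inj₂ (inj₂ (inj₂ refl)))  = inj₂ (inj₂ (inj₁ (trans (τ₀τ₂-comm (τ₀ x)) (cong τ₂ (τ₀-invol x)))))
      edgeFlag-τ₂ : ∀ {y} → EdgeFlag x y → EdgeFlag x (τ₂ y)
      edgeFlag-τ₂ (inj₁ refl)                = inj₂ (inj₂ (inj₁ refl))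
      edgeFlag-τ₂ (inj₂ (inj₁ refl))         = inj₂ (inj₂ (inj₂ refl))
      edgeFlag-τ₂ (inj₂ (inj₂ (inj₁ refl)))  = inj₁ (τ₂-invol x)
      edgeFlag-τ₂ (inj₂ (inj₂ (inj₂ refl)))  = inj₂ (inj₁ (τ₂-invol (τ₀ x)))

  sv-τ₂ : ∀ x → SameVertex premap x (τ₂ x)
  sv-τ₂ x = fwd (by-g x) ◅ ε

  sv-sym : ∀ {x y} → SameVertex premap x y → SameVertex premap y x
  sv-sym = symmetric _

  sv-reflexive : ∀ {x y} → x ≡ y → SameVertex premap x y
  sv-reflexive refl = ε

  module _ (Y : ℕ → Fin n) (step : ∀ k → NonBacktrackingStep (Y k) (Y (suc k))) (m : ℕ)
           (closes : SameVertex premap (Y 0) (Y (suc m)))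
           (distinct-vertices : ∀ {a b} → a < b → b ≤ m → ¬ SameVertex premap (Y a) (Y b)) where

    arrival-is-next : ∀ {a b} → a < b → b ≤ m → SameVertex premap (τ₀ (Y a)) (Y b) → b ≡ suc a
    arrival-is-next {a} {b} a<b b≤m τ₀Ya~Yb with m≤n⇒m<n∨m≡n a<b
    ... | inj₁ 1+a<b = contradiction (sv-sym (arrive (step a)) ◅◅ τ₀Ya~Yb) (distinct-vertices 1+a<b b≤m)
    ... | inj₂ 1+a≡b = sym 1+a≡b

    distinct-edges : ∀ {a b} → a < b → b ≤ m → ¬ SameEdge premap (Y a) (Y b)
    distinct-edges {a} {b} a<b b≤m a~b with sameEdge⇒edgeFlag a~b
    ... | inj₁ Yb≡Ya = distinct-vertices a<b b≤m (sv-reflexive (sym Yb≡Ya))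
    ... | inj₂ (inj₂ (inj₁ Yb≡τ₂Ya)) =
      distinct-vertices a<b b≤m (subst (SameVertex premap _) (sym Yb≡τ₂Ya) (sv-τ₂ _))
    ... | inj₂ (inj₁ Yb≡τ₀Ya)
      with refl ← arrival-is-next a<b b≤m (sv-reflexive (sym Yb≡τ₀Ya)) = ≢τ₀ (step a) Yb≡τ₀Ya
    ... | inj₂ (inj₂ (inj₂ Yb≡τ₂τ₀Ya))
      with refl ← arrival-is-next a<b b≤m (subst (SameVertex premap _) (sym Yb≡τ₂τ₀Ya) (sv-τ₂ _)) =
      ≢τ₂τ₀ (step a) Yb≡τ₂τ₀Ya

    closedWalk⇒cycle : Cycle G F
    closedWalk⇒cycle = m , Y ∘ toℕ , (∈F ∘ step ∘ toℕ) , links , closing , edges , vertices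
      where
        links : ∀ (k : Fin m) → SameVertex premap (τ₀ (Y (toℕ (inject₁ k)))) (Y (suc (toℕ k)))
        links k rewrite Fin.toℕ-inject₁ k = arrive (step (toℕ k))
        closing : SameVertex premap (τ₀ (Y (toℕ (fromℕ m)))) (Y 0)
        closing rewrite Fin.toℕ-fromℕ m = arrive (step m) ◅◅ sv-sym closes
        edges : ∀ i j → i ≢ j → ¬ SameEdge premap (Y (toℕ i)) (Y (toℕ j))
        edges = pairwise-on-Fin (λ a b → ¬ SameEdge premap (Y a) (Y b)) (λ ¬a~b → ¬a~b ∘ symmetric _)
                                distinct-edges
        vertices : ∀ i j → i ≢ j → ¬ SameVertex premap (Y (toℕ i)) (Y (toℕ j))
        vertices = pairwise-on-Fin (λ a b → ¬ SameVertex premap (Y a) (Y b)) (λ ¬a~b → ¬a~b ∘ sv-sym)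
                                   distinct-vertices

  module _ (X : ℕ → Fin n) (step : ∀ k → NonBacktrackingStep (X k) (X (suc k))) where

    Repeats : ℕ → Set
    Repeats j = ∃ λ i → i < j × SameVertex premap (X i) (X j)

    repeats? : ∀ j → Dec (Repeats j)
    repeats? j = anyUpTo? (λ i → Rotation.Vertex.sameVertex? G (X i) (X j)) j

    walk⇒cycle : Cycle G F
    walk⇒cycle with i , j , i<j , Xi≡Xj ← Fin.pigeonhole (n<1+n n) (X ∘ toℕ)
               with J , (I , I<J , XI~XJ) , first
                      ← leastWitness repeats? {toℕ j} (toℕ i , i<j , sv-reflexive Xi≡Xj)
               with m , 1+I+m≡J ← m≤n⇒∃[o]m+o≡n I<J =
      closedWalk⇒cycle (X ∘ (I +_)) shifted-step m closes distinct
      where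
        I+1+m≡J : I + suc m ≡ J
        I+1+m≡J = trans (+-suc I m) 1+I+m≡J
        shifted-step : ∀ k → NonBacktrackingStep (X (I + k)) (X (I + suc k))
        shifted-step k = subst (NonBacktrackingStep (X (I + k)) ∘ X) (sym (+-suc I k)) (step (I + k))
        closes : SameVertex premap (X (I + 0)) (X (I + suc m))
        closes = subst₂ (λ a b → SameVertex premap (X a) (X b)) (sym (+-identityʳ I)) (sym I+1+m≡J) XI~XJ
        distinct : ∀ {a b} → a < b → b ≤ m → ¬ SameVertex premap (X (I + a)) (X (I + b))
        distinct a<b b≤m Xa~Xb =
          first (subst (_ <_) I+1+m≡J (+-monoʳ-< I (s≤s b≤m))) (_ , +-monoʳ-< I a<b , Xa~Xb)

module ForestFlips (G : RibbonGraph) (F : EdgeSet G) (c : Fin (RibbonGraph.n G) → Bool)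
                  (c-τ₀ : ∀ z → c (RibbonGraph.τ₀ G z) ≡ c z)
                  (c-τ₁ : ∀ z → c (RibbonGraph.τ₁ G z) ≡ c z)
                  (c-flips-∉F : ∀ z → EdgeSet.mem F z ≡ false → c z ≢ c (RibbonGraph.τ₂ G z))
                  (eulerian : Eulerian (RibbonGraph.premap G)) where
  open RibbonGraph G
  open EdgeSet F
  open Iteration {Fin n}
  open Rotation G
  open Walks G F

  Unflipped : Fin n → Set
  Unflipped u = c u ≡ c (τ₂ u)

  unflipped-∈F : ∀ {u} → Unflipped u → mem u ≡ true
  unflipped-∈F {u} unflipped with mem u in u∈?F
  ... | false = contradiction unflipped (c-flips-∉F u u∈?F)
  ... | true  = refl

  unflipped-τ₀ : ∀ {u} → Unflipped u → Unflipped (τ₀ u)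
  unflipped-τ₀ {u} unflipped = begin
    c (τ₀ u)      ≡⟨ c-τ₀ u ⟩
    c u           ≡⟨ unflipped ⟩
    c (τ₂ u)      ≡⟨ c-τ₀ (τ₂ u) ⟨
    c (τ₀ (τ₂ u)) ≡⟨ cong c (τ₀τ₂-comm u) ⟩
    c (τ₂ (τ₀ u)) ∎
    where open ≡-Reasoning

  unflipped-elsewhere : ∀ {w} → Unflipped w → ∃ λ t → 0 < t × t < Vertex.degree w × Unflipped ((ρ ^ t) w)
  unflipped-elsewhere {w} unflipped
    with t , 0<t , t<d , repeats ← repeat-elsewhere (λ t → c ((ρ ^ t) w)) _
                                     (eulerian w (Vertex.degree w) (Vertex.hasDegree w)) (cong c (Vertex.ρ-period w))
                                     (trans (c-τ₁ (τ₂ w)) (sym unflipped)) =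
    t , 0<t , t<d , trans (sym repeats) (c-τ₁ _)

  next-unflipped : ∀ {u} → Unflipped u → ∃ λ v → Unflipped v × NonBacktrackingStep u v
  next-unflipped {u} unflipped with t , 0<t , t<d , unflipped′ ← unflipped-elsewhere (unflipped-τ₀ unflipped) =
    (ρ ^ t) (τ₀ u) , unflipped′ , record
      { ∈F     = unflipped-∈F unflipped
      ; arrive = ρ-sameVertex t (τ₀ u)
      ; ≢τ₀    = λ ρᵗτ₀u≡τ₀u → <⇒≢ 0<t (sym (Vertex.ρ-orbit-injective (τ₀ u) t<d z<s ρᵗτ₀u≡τ₀u))
      ; ≢τ₂τ₀  = ρ-avoids-τ₂ t (τ₀ u)
      }

  unflipped-walk : ∀ {u} → Unflipped u → ℕ → Σ (Fin n) Unflipped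
  unflipped-walk {u} unflipped zero = u , unflipped
  unflipped-walk unflipped (suc k) = map₂ proj₁ (next-unflipped (proj₂ (unflipped-walk unflipped k)))

  no-unflipped : IsForest G F → ∀ {u} → ¬ Unflipped u
  no-unflipped forest unflipped = forest (walk⇒cycle (proj₁ ∘ unflipped-walk unflipped) step)
    where
      step : ∀ k → NonBacktrackingStep (proj₁ (unflipped-walk unflipped k)) (proj₁ (unflipped-walk unflipped (suc k)))
      step k = proj₂ (proj₂ (next-unflipped (proj₂ (unflipped-walk unflipped k))))

lemma4p2 : (G : RibbonGraph) (F : EdgeSet G)
    → Eulerian (RibbonGraph.premap G)
    → IsForest G F
    → CheckerboardColourableContraction G F
    → CheckerboardColourable (RibbonGraph.premap G)
lemma4p2 G F eulerian forest (c′ , c′-boundary , c′-flip) =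
  colour , (λ _ _ → gfold isEquivalence colour colour-step) ,
  (λ _ → ForestFlips.no-unflipped G F colour colour-τ₀ colour-τ₁ colour-flips-∉F eulerian forest)
  where
    open RibbonGraph G
    open BoundaryWalk.LiftedColouring G F c′ c′-boundary c′-flip
    colour-step : ∀ {x y} → Gen τ₀ τ₁ x y → colour x ≡ colour y
    colour-step (by-f z) = sym (colour-τ₀ z)
    colour-step (by-g z) = sym (colour-τ₁ z)
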